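{- Let $d>2\varepsilon>0$. There exists an integer $t=t(d,\varepsilon)$ such that the following holds. Let $G$ be a bipartite graph with parts $V_1$ and $V_2$ such that $(V_1,V_2)$ is $\varepsilon$-regular with density at least $d$, and $|V_1|$ is sufficiently large. Then there exist vertices $u_1,\dots,u_t\in V_1$ such that \[ \Bigl|\bigcup_{i=1}^t N(u_i)\Bigr|\ge(1-\varepsilon)|V_2|. \]
   Context: For disjoint vertex sets $X,Y$, $d(X,Y)=e(X,Y)/(|X||Y|)$ with $e(X,Y)$ the number of edges between $X$ and $Y$. A pair $(A,B)$ is $\varepsilon$-regular if for all $X\subseteq A$, $Y\subseteq B$ with $|X|\ge\varepsilon|A|$, $|Y|\ge\varepsilon|B|$, $|d(X,Y)-d(A,B)|\le\varepsilon$. $N(u)$ denotes the neighbourhood of $u$.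
   Formalization: The parameters d and ε with $d>2\varepsilon>0$ range over the rationals. -}

module Defs where

open import Data.Bool using (Bool; true; false)
open import Data.Nat using (ℕ; zero; suc) renaming (_*_ to _*ℕ_)
open import Data.Integer using (+_)
open import Data.Fin using (Fin)
open import Data.List using (List; map; allFin)
open import Data.Nat.ListAction using (sum)
import Data.Vec
open import Data.Vec using (tabulate)
import Data.Fin.Subset
open import Data.Fin.Subset using (Subset; ⊤; ∣_∣; _∩_; _∈_)
open import Data.Rational using (ℚ; 0ℚ; _/_; _*_; _-_; _≤_) renaming (∣_∣ to abs)
open import Data.Product using (Σ; _×_)

BipGraph : ℕ → ℕ → Set
BipGraph n₁ n₂ = Fin n₁ → Fin n₂ → Bool

ℕ→ℚ : ℕ → ℚ
ℕ→ℚ n = + n / 1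

N : ∀ {n₁ n₂} → BipGraph n₁ n₂ → Fin n₁ → Subset n₂
N G u = tabulate (G u)

e : ∀ {n₁ n₂} → BipGraph n₁ n₂ → Subset n₁ → Subset n₂ → ℕ
e {n₁} G X Y = sum (map count₁ (allFin n₁))
  where
  count₁ : Fin n₁ → ℕ
  count₁ x with Data.Vec.lookup X x
  ... | true  = ∣ N G x ∩ Y ∣
  ... | false = 0

-- e / m as a rational (with the convention that it is 0 when m = 0;
-- this case never arises in the regularity condition below since ε > 0
-- forces nonempty X, Y whenever the parts are nonempty)
ratio : ℕ → ℕ → ℚ
ratio a zero    = 0ℚ
ratio a (suc m) = + a / suc m

density : ∀ {n₁ n₂} → BipGraph n₁ n₂ → Subset n₁ → Subset n₂ → ℚ
density G X Y = ratio (e G X Y) (∣ X ∣ *ℕ ∣ Y ∣)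

IsRegular : ∀ {n₁ n₂} → ℚ → BipGraph n₁ n₂ → Set
IsRegular {n₁} {n₂} ε G =
  (X : Subset n₁) (Y : Subset n₂) →
  ε * ℕ→ℚ n₁ ≤ ℕ→ℚ ∣ X ∣ → ε * ℕ→ℚ n₂ ≤ ℕ→ℚ ∣ Y ∣ →
  abs (density G X Y - density G ⊤ ⊤) ≤ ε

NbUnion : ∀ {n₁ n₂ t} → BipGraph n₁ n₂ → (Fin t → Fin n₁) → Subset n₂
NbUnion G u = Data.Fin.Subset.⋃ (map (λ i → N G (u i)) (allFin _))

{-# OPTIONS --safe #-}

-- Starting from Y₀ = V₂, repeatedly pick the vertex u ∈ V₁ with the most
-- neighbours in the still uncovered set Yₖ and put Yₖ₊₁ = Yₖ ∖ N(u). While ∣Yₖ∣ ≥ ε∣V₂∣,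
-- regularity applied to (V₁, Yₖ) gives d(V₁, Yₖ) ≥ d − ε > ε, so by averaging u covers at
-- least ε∣Yₖ∣ ≥ ε²∣V₂∣ new vertices. Hence any t ≥ 1/ε² rounds leave at most ε∣V₂∣ vertices
-- uncovered, and N₀ = 1 suffices. (For ε ≥ 1 the bound is vacuous.)

module Submission where

open import Defs
open import Data.Bool using (true; false)
open import Data.Nat as ℕ using (ℕ; zero; suc; z≤n; s≤s; _≥_)
import Data.Nat.Properties as ℕ
open import Data.Nat.Coprimality as Coprime using ()
open import Data.Nat.ListAction using (sum)
open import Data.Integer as ℤ using (+0; +[1+_]; -[1+_])
import Data.Integer.Properties as ℤ
open import Data.Fin using (Fin; zero; toℕ; fromℕ; inject₁)
open import Data.Fin.Properties using (toℕ-fromℕ; toℕ-inject₁)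
open import Data.Fin.Subset using (Subset; ⊤; ∣_∣; _∩_; _∪_; _─_; ⋃; _∈_; _⊆_)
open import Data.Fin.Subset.Properties
  using (_∈?_; ∈⊤; ∣⊤∣≡n; p⊆q⇒∣p∣≤∣q∣; ∣p─q∣≤∣p∣; x∈p∪q⁺; x∈p∧x∉q⇒x∈p─q)
open import Data.List using (List; map; allFin; length)
open import Data.List.Properties using (length-tabulate)
open import Data.List.Extrema.Nat using (argmax; f[xs]≤f[argmax])
open import Data.List.Membership.Propositional using () renaming (_∈_ to _∈ₗ_)
open import Data.List.Membership.Propositional.Properties using (∈-map⁺; ∈-allFin)
import Data.List.Relation.Unary.All as All
open import Data.List.Relation.Unary.Any using (here; there)
open import Data.Vec using ([]; _∷_; lookup)
open import Data.Rational
  using ( ℚ; mkℚ; 0ℚ; 1ℚ; _+_; _*_; _-_; -_; _≤_; _<_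
        ; Positive; NonNegative; positive; nonNegative; toℚᵘ; *≤*; *<*)
  renaming (∣_∣ to abs)
open import Data.Rational.Properties
import Data.Rational.Unnormalised as ℚᵘ
import Data.Rational.Unnormalised.Properties as ℚᵘ
open import Data.Rational.Solver using (module +-*-Solver)
open import Data.Product using (Σ; ∃; _,_; proj₁)
open import Data.Sum as Sum using (_⊎_; inj₁; inj₂)
open import Relation.Nullary using (yes; no)
open import Relation.Binary.PropositionalEquality

open +-*-Solver

ℕ→ℚ≡mkℚ : ∀ n → ℕ→ℚ n ≡ mkℚ (ℤ.+ n) 0 (Coprime.sym (Coprime.1-coprimeTo n))
ℕ→ℚ≡mkℚ n = normalize-coprime _

ℕ→ℚ-homo-+ : ∀ m n → ℕ→ℚ (m ℕ.+ n) ≡ ℕ→ℚ m + ℕ→ℚ n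
ℕ→ℚ-homo-+ m n rewrite ℕ→ℚ≡mkℚ m | ℕ→ℚ≡mkℚ n =
  cong (_/ 1) (sym (cong₂ ℤ._+_ (ℤ.*-identityʳ (ℤ.+ m)) (ℤ.*-identityʳ (ℤ.+ n))))
  where open Data.Rational using (_/_)

ℕ→ℚ-homo-* : ∀ m n → ℕ→ℚ (m ℕ.* n) ≡ ℕ→ℚ m * ℕ→ℚ n
ℕ→ℚ-homo-* m n rewrite ℕ→ℚ≡mkℚ m | ℕ→ℚ≡mkℚ n = cong (_/ 1) (ℤ.pos-* m n)
  where open Data.Rational using (_/_)

ℕ→ℚ-mono-≤ : ∀ {m n} → m ℕ.≤ n → ℕ→ℚ m ≤ ℕ→ℚ n
ℕ→ℚ-mono-≤ {m} {n} m≤n rewrite ℕ→ℚ≡mkℚ m | ℕ→ℚ≡mkℚ n =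
  *≤* (ℤ.*-monoʳ-≤-nonNeg (ℤ.+ 1) (ℤ.+≤+ m≤n))

ℕ→ℚ-nonNeg : ∀ n → NonNegative (ℕ→ℚ n)
ℕ→ℚ-nonNeg n rewrite ℕ→ℚ≡mkℚ n = _

ℕ→ℚ-pos : ∀ n → Positive (ℕ→ℚ (suc n))
ℕ→ℚ-pos n rewrite ℕ→ℚ≡mkℚ (suc n) = _

ratio-*-cancel : ∀ a m → ratio a (suc m) * ℕ→ℚ (suc m) ≡ ℕ→ℚ a
ratio-*-cancel a m = toℚᵘ-injective (begin-equality
  toℚᵘ (ratio a (suc m) * ℕ→ℚ (suc m))
    ≃⟨ toℚᵘ-homo-* (ratio a (suc m)) (ℕ→ℚ (suc m)) ⟩
  toℚᵘ (ratio a (suc m)) ℚᵘ.* toℚᵘ (ℕ→ℚ (suc m))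
    ≃⟨ ℚᵘ.*-cong (toℚᵘ-fromℚᵘ (ℚᵘ.mkℚᵘ (ℤ.+ a) m)) (toℚᵘ-fromℚᵘ (ℚᵘ.mkℚᵘ (ℤ.+ suc m) 0)) ⟩
  ℚᵘ.mkℚᵘ (ℤ.+ a) m ℚᵘ.* ℚᵘ.mkℚᵘ (ℤ.+ suc m) 0
    ≃⟨ ℚᵘ.*≡* (trans (ℤ.*-identityʳ _) (cong (λ k → ℤ.+ a ℤ.* ℤ.+ k) (sym (ℕ.*-identityʳ (suc m))))) ⟩
  ℚᵘ.mkℚᵘ (ℤ.+ a) 0
    ≃⟨ toℚᵘ-fromℚᵘ (ℚᵘ.mkℚᵘ (ℤ.+ a) 0) ⟨
  toℚᵘ (ℕ→ℚ a) ∎)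
  where open ℚᵘ.≤-Reasoning

ratio-*-≤ : ∀ a m → ratio a m * ℕ→ℚ m ≤ ℕ→ℚ a
ratio-*-≤ a zero    = ℕ→ℚ-mono-≤ {0} {a} z≤n
ratio-*-≤ a (suc m) = ≤-reflexive (ratio-*-cancel a m)

archimedean : ∀ p → 0ℚ < p → ∃ λ t → 1ℚ ≤ ℕ→ℚ t * p
archimedean p@(mkℚ +[1+ k ] b _) _ = suc b , (begin
  1ℚ                             ≤⟨ ℕ→ℚ-mono-≤ {1} {suc k} (s≤s z≤n) ⟩
  ℕ→ℚ (suc k)                    ≡⟨ ratio-*-cancel (suc k) b ⟨
  ratio (suc k) (suc b) * ℕ→ℚ (suc b) ≡⟨ cong (_* ℕ→ℚ (suc b)) (fromℚᵘ-toℚᵘ p) ⟩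
  p * ℕ→ℚ (suc b)                ≡⟨ *-comm p (ℕ→ℚ (suc b)) ⟩
  ℕ→ℚ (suc b) * p                ∎)
  where open ≤-Reasoning
archimedean (mkℚ +0         _ _) (*<* (ℤ.+<+ ()))
archimedean (mkℚ -[1+ _ ] _ _) (*<* ())

+-cancelʳ-≤ : ∀ r {p q} → p + r ≤ q + r → p ≤ q
+-cancelʳ-≤ r {p} {q} p+r≤q+r = subst₂ _≤_ (cancel p) (cancel q) (+-monoˡ-≤ (- r) p+r≤q+r)
  where
  cancel : ∀ x → x + r + - r ≡ x
  cancel x = solve 2 (λ x r → x :+ r :+ :- r := x) refl x r

-p≤∣p∣ : ∀ p → - p ≤ abs p
-p≤∣p∣ p with ∣p∣≡p∨∣p∣≡-p p
... | inj₁ ∣p∣≡p  = ≤-trans (neg-antimono-≤ (∣p∣≡p⇒0≤p ∣p∣≡p)) (0≤∣p∣ p)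
... | inj₂ ∣p∣≡-p = ≤-reflexive (sym ∣p∣≡-p)

∣p-q∣≤r⇒q≤p+r : ∀ {p q r} → abs (p - q) ≤ r → q ≤ p + r
∣p-q∣≤r⇒q≤p+r {p} {q} {r} ∣p-q∣≤r = begin
  q               ≡⟨ solve 2 (λ p q → q := p :+ :- (p :+ :- q)) refl p q ⟩
  p + - (p - q)   ≤⟨ +-monoʳ-≤ p (≤-trans (-p≤∣p∣ (p - q)) ∣p-q∣≤r) ⟩
  p + r           ∎
  where open ≤-Reasoning

1≤p⇒[1-p]*m≤n : ∀ {p} m n → 1ℚ ≤ p → (1ℚ - p) * ℕ→ℚ m ≤ ℕ→ℚ n
1≤p⇒[1-p]*m≤n {p} m n 1≤p = begin
  (1ℚ - p) * ℕ→ℚ m ≤⟨ *-monoʳ-≤-nonNeg (ℕ→ℚ m) {{ℕ→ℚ-nonNeg m}} 1-p≤0 ⟩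
  0ℚ * ℕ→ℚ m       ≡⟨ *-zeroˡ (ℕ→ℚ m) ⟩
  0ℚ               ≤⟨ ℕ→ℚ-mono-≤ {0} {n} z≤n ⟩
  ℕ→ℚ n            ∎
  where
  open ≤-Reasoning
  1-p≤0 : 1ℚ - p ≤ 0ℚ
  1-p≤0 = ≤-trans (+-monoˡ-≤ (- p) 1≤p) (≤-reflexive (+-inverseʳ p))

0<p⇒0<p*p : ∀ {p} → 0ℚ < p → 0ℚ < p * p
0<p⇒0<p*p {p} 0<p = positive⁻¹ (p * p) {{pos*pos⇒pos p {{positive 0<p}} p {{positive 0<p}}}}

-- Each step above the threshold θ costs at least s, and a₀ ≤ t s leaves no room for t such steps.
descent : (a : ℕ → ℚ) {θ s : ℚ} → 0ℚ ≤ θ →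
  (∀ k → a (suc k) ≤ a k) →
  (∀ k → θ < a k → a (suc k) + s ≤ a k) →
  ∀ t → a 0 ≤ ℕ→ℚ t * s → a t ≤ θ
descent a {θ} {s} 0≤θ decreasing step t a₀≤ts with a t ≤? θ
... | yes aₜ≤θ = aₜ≤θ
... | no  aₜ≰θ = ≤-trans aₜ≤0 0≤θ
  where
  total-drop : ∀ k → θ < a k → a k + ℕ→ℚ k * s ≤ a 0
  total-drop zero    _        =
    ≤-reflexive (trans (cong (λ x → a 0 + x) (*-zeroˡ s)) (+-identityʳ (a 0)))
  total-drop (suc k) θ<aₖ₊₁ = begin
    a (suc k) + ℕ→ℚ (suc k) * s  ≡⟨ cong (λ x → a (suc k) + x * s) (ℕ→ℚ-homo-+ 1 k) ⟩
    a (suc k) + (1ℚ + ℕ→ℚ k) * s ≡⟨ solve 3 (λ a k s → a :+ (con 1ℚ :+ k) :* s := (a :+ s) :+ k :* s)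
                                           refl (a (suc k)) (ℕ→ℚ k) s ⟩
    a (suc k) + s + ℕ→ℚ k * s    ≤⟨ +-monoˡ-≤ (ℕ→ℚ k * s) (step k θ<aₖ) ⟩
    a k + ℕ→ℚ k * s              ≤⟨ total-drop k θ<aₖ ⟩
    a 0                          ∎
    where
    open ≤-Reasoning
    θ<aₖ : θ < a k
    θ<aₖ = <-≤-trans θ<aₖ₊₁ (decreasing k)
  aₜ≤0 : a t ≤ 0ℚ
  aₜ≤0 = +-cancelʳ-≤ (ℕ→ℚ t * s) (begin
    a t + ℕ→ℚ t * s ≤⟨ total-drop t (≰⇒> aₜ≰θ) ⟩
    a 0             ≤⟨ a₀≤ts ⟩
    ℕ→ℚ t * s       ≡⟨ +-identityˡ (ℕ→ℚ t * s) ⟨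
    0ℚ + ℕ→ℚ t * s  ∎)
    where open ≤-Reasoning

∣p─q∣+∣q∩p∣≡∣p∣ : ∀ {n} (p q : Subset n) → ∣ p ─ q ∣ ℕ.+ ∣ q ∩ p ∣ ≡ ∣ p ∣
∣p─q∣+∣q∩p∣≡∣p∣ []         []         = refl
∣p─q∣+∣q∩p∣≡∣p∣ (true ∷ p)  (true ∷ q)  = trans (ℕ.+-suc _ _) (cong suc (∣p─q∣+∣q∩p∣≡∣p∣ p q))
∣p─q∣+∣q∩p∣≡∣p∣ (true ∷ p)  (false ∷ q) = cong suc (∣p─q∣+∣q∩p∣≡∣p∣ p q)
∣p─q∣+∣q∩p∣≡∣p∣ (false ∷ p) (true ∷ q)  = ∣p─q∣+∣q∩p∣≡∣p∣ p q
∣p─q∣+∣q∩p∣≡∣p∣ (false ∷ p) (false ∷ q) = ∣p─q∣+∣q∩p∣≡∣p∣ p q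

∣p∪q∣≤∣p∣+∣q∣ : ∀ {n} (p q : Subset n) → ∣ p ∪ q ∣ ℕ.≤ ∣ p ∣ ℕ.+ ∣ q ∣
∣p∪q∣≤∣p∣+∣q∣ []          []          = z≤n
∣p∪q∣≤∣p∣+∣q∣ (true ∷ p)  (true ∷ q)  =
  s≤s (ℕ.≤-trans (∣p∪q∣≤∣p∣+∣q∣ p q) (ℕ.+-monoʳ-≤ ∣ p ∣ (ℕ.n≤1+n ∣ q ∣)))
∣p∪q∣≤∣p∣+∣q∣ (true ∷ p)  (false ∷ q) = s≤s (∣p∪q∣≤∣p∣+∣q∣ p q)
∣p∪q∣≤∣p∣+∣q∣ (false ∷ p) (true ∷ q)  =
  subst (suc ∣ p ∪ q ∣ ℕ.≤_) (sym (ℕ.+-suc ∣ p ∣ ∣ q ∣)) (s≤s (∣p∪q∣≤∣p∣+∣q∣ p q))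
∣p∪q∣≤∣p∣+∣q∣ (false ∷ p) (false ∷ q) = ∣p∪q∣≤∣p∣+∣q∣ p q

x∈p⇒x∈p─q⊎x∈q : ∀ {n x} {p q : Subset n} → x ∈ p → x ∈ p ─ q ⊎ x ∈ q
x∈p⇒x∈p─q⊎x∈q {x = x} {q = q} x∈p with x ∈? q
... | yes x∈q = inj₂ x∈q
... | no  x∉q = inj₁ (x∈p∧x∉q⇒x∈p─q x∈p x∉q)

x∈⋃⁺ : ∀ {n x} {p : Subset n} {ps} → p ∈ₗ ps → x ∈ p → x ∈ ⋃ ps
x∈⋃⁺ (here refl) x∈p = x∈p∪q⁺ (inj₁ x∈p)
x∈⋃⁺ (there p∈ps) x∈p = x∈p∪q⁺ (inj₂ (x∈⋃⁺ p∈ps x∈p))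

sum-map-≤ : ∀ {A : Set} (f : A → ℕ) {M} → (∀ x → f x ℕ.≤ M) →
  ∀ xs → sum (map f xs) ℕ.≤ length xs ℕ.* M
sum-map-≤ f f≤M List.[]       = z≤n
sum-map-≤ f f≤M (x List.∷ xs) = ℕ.+-mono-≤ (f≤M x) (sum-map-≤ f f≤M xs)

module _ {n₁ n₂} (G : BipGraph n₁ n₂) where

  -- Defs keeps the summand of e local; unification against the unfolding of e names it.
  e-as-sum : ∀ X Y → ∃ λ (f : Fin n₁ → ℕ) → e G X Y ≡ sum (map f (allFin n₁))
  e-as-sum X Y = _ , refl

  e-summand-≤ : ∀ X Y x → proj₁ (e-as-sum X Y) x ℕ.≤ ∣ N G x ∩ Y ∣
  e-summand-≤ X Y x with lookup X x
  ... | true  = ℕ.≤-refl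
  ... | false = z≤n

  e≤n₁*maxDegree : ∀ X Y {M} → (∀ x → ∣ N G x ∩ Y ∣ ℕ.≤ M) → e G X Y ℕ.≤ n₁ ℕ.* M
  e≤n₁*maxDegree X Y {M} deg≤M =
    subst (λ n → e G X Y ℕ.≤ n ℕ.* M) (length-tabulate {n = n₁} (λ i → i))
      (sum-map-≤ (proj₁ (e-as-sum X Y)) (λ x → ℕ.≤-trans (e-summand-≤ X Y x) (deg≤M x)) (allFin n₁))

  ∈N⇒∈NbUnion : ∀ {t x} (u : Fin t → Fin n₁) i → x ∈ N G (u i) → x ∈ NbUnion G u
  ∈N⇒∈NbUnion u i = x∈⋃⁺ (∈-map⁺ (λ i → N G (u i)) (∈-allFin i))

module Greedy {n₁ n₂} (G : BipGraph (suc n₁) n₂) where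

  degreeInto : Subset n₂ → Fin (suc n₁) → ℕ
  degreeInto Y x = ∣ N G x ∩ Y ∣

  bestVertex : Subset n₂ → Fin (suc n₁)
  bestVertex Y = argmax (degreeInto Y) zero (allFin (suc n₁))

  degreeInto≤best : ∀ Y x → degreeInto Y x ℕ.≤ degreeInto Y (bestVertex Y)
  degreeInto≤best Y x =
    All.lookup (f[xs]≤f[argmax] {f = degreeInto Y} zero (allFin (suc n₁))) (∈-allFin x)

  uncovered : ℕ → Subset n₂
  uncovered zero    = ⊤
  uncovered (suc k) = uncovered k ─ N G (bestVertex (uncovered k))

  chosen : ℕ → Fin (suc n₁)
  chosen k = bestVertex (uncovered k)

  choice : (t : ℕ) → Fin t → Fin (suc n₁)
  choice t i = chosen (toℕ i)

  ∣uncovered∣-step : ∀ k →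
    ∣ uncovered (suc k) ∣ ℕ.+ degreeInto (uncovered k) (chosen k) ≡ ∣ uncovered k ∣
  ∣uncovered∣-step k = ∣p─q∣+∣q∩p∣≡∣p∣ (uncovered k) (N G (chosen k))

  Covered : ℕ → Fin n₂ → Set
  Covered k x = ∃ λ (j : Fin k) → x ∈ N G (chosen (toℕ j))

  covered-suc : ∀ {k x} → Covered k x → Covered (suc k) x
  covered-suc {x = x} (j , x∈N) =
    inject₁ j , subst (λ i → x ∈ N G (chosen i)) (sym (toℕ-inject₁ j)) x∈N

  covered-by-chosen : ∀ {k x} → x ∈ N G (chosen k) → Covered (suc k) x
  covered-by-chosen {k} {x} x∈N =
    fromℕ k , subst (λ i → x ∈ N G (chosen i)) (sym (toℕ-fromℕ k)) x∈N

  uncovered-or-covered : ∀ k x → x ∈ uncovered k ⊎ Covered k x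
  uncovered-or-covered zero    x = inj₁ ∈⊤
  uncovered-or-covered (suc k) x = step (uncovered-or-covered k x)
    where
    step : x ∈ uncovered k ⊎ Covered k x → x ∈ uncovered (suc k) ⊎ Covered (suc k) x
    step (inj₁ x∈Y) = Sum.map₂ covered-by-chosen (x∈p⇒x∈p─q⊎x∈q {q = N G (chosen k)} x∈Y)
    step (inj₂ c)   = inj₂ (covered-suc c)

  covered⇒∈NbUnion : ∀ {t x} → Covered t x → x ∈ NbUnion G (choice t)
  covered⇒∈NbUnion {t} (j , x∈N) = ∈N⇒∈NbUnion G (choice t) j x∈N

  n₂≤∣uncovered∣+∣NbUnion∣ : ∀ t → n₂ ℕ.≤ ∣ uncovered t ∣ ℕ.+ ∣ NbUnion G (choice t) ∣
  n₂≤∣uncovered∣+∣NbUnion∣ t = begin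
    n₂                                          ≡⟨ ∣⊤∣≡n n₂ ⟨
    ∣ ⊤ {n₂} ∣                                  ≤⟨ p⊆q⇒∣p∣≤∣q∣ ⊤⊆uncovered∪NbUnion ⟩
    ∣ uncovered t ∪ NbUnion G (choice t) ∣      ≤⟨ ∣p∪q∣≤∣p∣+∣q∣ (uncovered t) (NbUnion G (choice t)) ⟩
    ∣ uncovered t ∣ ℕ.+ ∣ NbUnion G (choice t) ∣ ∎
    where
    open ℕ.≤-Reasoning
    ⊤⊆uncovered∪NbUnion : ⊤ ⊆ uncovered t ∪ NbUnion G (choice t)
    ⊤⊆uncovered∪NbUnion {x} _ =
      x∈p∪q⁺ (Sum.map₂ covered⇒∈NbUnion (uncovered-or-covered t x))

  ε*∣Y∣≤maxDegree : ∀ {ε} Y v → (∀ x → degreeInto Y x ℕ.≤ degreeInto Y v) →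
    ε ≤ density G ⊤ Y → ε * ℕ→ℚ ∣ Y ∣ ≤ ℕ→ℚ (degreeInto Y v)
  ε*∣Y∣≤maxDegree {ε} Y v v-max ε≤density =
   *-cancelˡ-≤-pos (ℕ→ℚ (suc n₁)) {{ℕ→ℚ-pos n₁}} (begin
    ℕ→ℚ (suc n₁) * (ε * ℕ→ℚ ∣ Y ∣)
      ≡⟨ solve 3 (λ n ε y → n :* (ε :* y) := ε :* (n :* y)) refl (ℕ→ℚ (suc n₁)) ε (ℕ→ℚ ∣ Y ∣) ⟩
    ε * (ℕ→ℚ (suc n₁) * ℕ→ℚ ∣ Y ∣)
      ≡⟨ cong (ε *_) (ℕ→ℚ-homo-* (suc n₁) ∣ Y ∣) ⟨
    ε * ℕ→ℚ (suc n₁ ℕ.* ∣ Y ∣)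
      ≡⟨ cong (λ n → ε * ℕ→ℚ (n ℕ.* ∣ Y ∣)) (∣⊤∣≡n (suc n₁)) ⟨
    ε * ℕ→ℚ (∣ ⊤ {suc n₁} ∣ ℕ.* ∣ Y ∣)
      ≤⟨ *-monoʳ-≤-nonNeg (ℕ→ℚ (∣ ⊤ {suc n₁} ∣ ℕ.* ∣ Y ∣))
           {{ℕ→ℚ-nonNeg (∣ ⊤ {suc n₁} ∣ ℕ.* ∣ Y ∣)}} ε≤density ⟩
    density G ⊤ Y * ℕ→ℚ (∣ ⊤ {suc n₁} ∣ ℕ.* ∣ Y ∣)
      ≤⟨ ratio-*-≤ (e G ⊤ Y) (∣ ⊤ {suc n₁} ∣ ℕ.* ∣ Y ∣) ⟩
    ℕ→ℚ (e G ⊤ Y)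
      ≤⟨ ℕ→ℚ-mono-≤ (e≤n₁*maxDegree G ⊤ Y v-max) ⟩
    ℕ→ℚ (suc n₁ ℕ.* degreeInto Y v)
      ≡⟨ ℕ→ℚ-homo-* (suc n₁) (degreeInto Y v) ⟩
    ℕ→ℚ (suc n₁) * ℕ→ℚ (degreeInto Y v) ∎)
    where open ≤-Reasoning

  -- Nested here so that `choice` below is literally Greedy.choice: the copies made by
  -- `open Greedy G` would only be convertible after unfolding ℕ→ℚ, which is very slow.
  module _ {d ε : ℚ} (0<ε : 0ℚ < ε) (ε≤1 : ε ≤ 1ℚ) (2ε<d : ε + ε < d)
           (regular : IsRegular ε G) (d≤density : d ≤ density G ⊤ ⊤) where

    ε-nonNeg : NonNegative ε
    ε-nonNeg = nonNegative (<⇒≤ 0<ε)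

    0≤εn₂ : 0ℚ ≤ ε * ℕ→ℚ n₂
    0≤εn₂ = nonNegative⁻¹ (ε * ℕ→ℚ n₂)
      {{nonNeg*nonNeg⇒nonNeg ε {{ε-nonNeg}} (ℕ→ℚ n₂) {{ℕ→ℚ-nonNeg n₂}}}}

    large⇒ε≤density : ∀ Y → ε * ℕ→ℚ n₂ ≤ ℕ→ℚ ∣ Y ∣ → ε ≤ density G ⊤ Y
    large⇒ε≤density Y εn₂≤∣Y∣ = +-cancelʳ-≤ ε (begin
      ε + ε             <⟨ 2ε<d ⟩
      d                 ≤⟨ d≤density ⟩
      density G ⊤ ⊤     ≤⟨ ∣p-q∣≤r⇒q≤p+r {density G ⊤ Y} (regular ⊤ Y V₁-large εn₂≤∣Y∣) ⟩
      density G ⊤ Y + ε ∎)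
      where
      open ≤-Reasoning
      V₁-large : ε * ℕ→ℚ (suc n₁) ≤ ℕ→ℚ ∣ ⊤ {suc n₁} ∣
      V₁-large = begin
        ε * ℕ→ℚ (suc n₁)  ≤⟨ *-monoʳ-≤-nonNeg (ℕ→ℚ (suc n₁)) {{ℕ→ℚ-nonNeg (suc n₁)}} ε≤1 ⟩
        1ℚ * ℕ→ℚ (suc n₁) ≡⟨ *-identityˡ (ℕ→ℚ (suc n₁)) ⟩
        ℕ→ℚ (suc n₁)      ≡⟨ cong ℕ→ℚ (∣⊤∣≡n (suc n₁)) ⟨
        ℕ→ℚ ∣ ⊤ {suc n₁} ∣ ∎

    greedy-step : ∀ k → ε * ℕ→ℚ n₂ < ℕ→ℚ ∣ uncovered k ∣ →
      ℕ→ℚ ∣ uncovered (suc k) ∣ + ε * (ε * ℕ→ℚ n₂) ≤ ℕ→ℚ ∣ uncovered k ∣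
    greedy-step k εn₂<∣Y∣ = begin
      ℕ→ℚ ∣ uncovered (suc k) ∣ + ε * (ε * ℕ→ℚ n₂)
        ≤⟨ +-monoʳ-≤ (ℕ→ℚ ∣ uncovered (suc k) ∣) (*-monoˡ-≤-nonNeg ε {{ε-nonNeg}} (<⇒≤ εn₂<∣Y∣)) ⟩
      ℕ→ℚ ∣ uncovered (suc k) ∣ + ε * ℕ→ℚ ∣ uncovered k ∣
        ≤⟨ +-monoʳ-≤ (ℕ→ℚ ∣ uncovered (suc k) ∣)
             (ε*∣Y∣≤maxDegree (uncovered k) (chosen k) (degreeInto≤best (uncovered k))
               (large⇒ε≤density (uncovered k) (<⇒≤ εn₂<∣Y∣))) ⟩
      ℕ→ℚ ∣ uncovered (suc k) ∣ + ℕ→ℚ (degreeInto (uncovered k) (chosen k))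
        ≡⟨ ℕ→ℚ-homo-+ ∣ uncovered (suc k) ∣ (degreeInto (uncovered k) (chosen k)) ⟨
      ℕ→ℚ (∣ uncovered (suc k) ∣ ℕ.+ degreeInto (uncovered k) (chosen k))
        ≡⟨ cong ℕ→ℚ (∣uncovered∣-step k) ⟩
      ℕ→ℚ ∣ uncovered k ∣ ∎
      where open ≤-Reasoning

    greedy-covers : ∀ t → 1ℚ ≤ ℕ→ℚ t * (ε * ε) →
      (1ℚ - ε) * ℕ→ℚ n₂ ≤ ℕ→ℚ ∣ NbUnion G (choice t) ∣
    greedy-covers t 1≤tε² = +-cancelʳ-≤ (ε * ℕ→ℚ n₂) (begin
      (1ℚ - ε) * ℕ→ℚ n₂ + ε * ℕ→ℚ n₂
        ≡⟨ solve 2 (λ ε n → (con 1ℚ :+ :- ε) :* n :+ ε :* n := n) refl ε (ℕ→ℚ n₂) ⟩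
      ℕ→ℚ n₂
        ≤⟨ ℕ→ℚ-mono-≤ (n₂≤∣uncovered∣+∣NbUnion∣ t) ⟩
      ℕ→ℚ (∣ uncovered t ∣ ℕ.+ ∣ NbUnion G (choice t) ∣)
        ≡⟨ ℕ→ℚ-homo-+ ∣ uncovered t ∣ ∣ NbUnion G (choice t) ∣ ⟩
      ℕ→ℚ ∣ uncovered t ∣ + ℕ→ℚ ∣ NbUnion G (choice t) ∣
        ≤⟨ +-monoˡ-≤ (ℕ→ℚ ∣ NbUnion G (choice t) ∣) few-uncovered ⟩
      ε * ℕ→ℚ n₂ + ℕ→ℚ ∣ NbUnion G (choice t) ∣
        ≡⟨ +-comm (ε * ℕ→ℚ n₂) (ℕ→ℚ ∣ NbUnion G (choice t) ∣) ⟩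
      ℕ→ℚ ∣ NbUnion G (choice t) ∣ + ε * ℕ→ℚ n₂ ∎)
      where
      open ≤-Reasoning
      n₂≤tε²n₂ : ℕ→ℚ ∣ uncovered 0 ∣ ≤ ℕ→ℚ t * (ε * (ε * ℕ→ℚ n₂))
      n₂≤tε²n₂ = begin
        ℕ→ℚ ∣ uncovered 0 ∣         ≡⟨ cong ℕ→ℚ {x = ∣ uncovered 0 ∣} (∣⊤∣≡n n₂) ⟩
        ℕ→ℚ n₂                     ≡⟨ *-identityˡ (ℕ→ℚ n₂) ⟨
        1ℚ * ℕ→ℚ n₂                ≤⟨ *-monoʳ-≤-nonNeg (ℕ→ℚ n₂) {{ℕ→ℚ-nonNeg n₂}} 1≤tε² ⟩
        ℕ→ℚ t * (ε * ε) * ℕ→ℚ n₂   ≡⟨ solve 3 (λ t ε n → t :* (ε :* ε) :* n := t :* (ε :* (ε :* n)))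
                                              refl (ℕ→ℚ t) ε (ℕ→ℚ n₂) ⟩
        ℕ→ℚ t * (ε * (ε * ℕ→ℚ n₂)) ∎
      few-uncovered : ℕ→ℚ ∣ uncovered t ∣ ≤ ε * ℕ→ℚ n₂
      few-uncovered = descent (λ k → ℕ→ℚ ∣ uncovered k ∣) 0≤εn₂
        (λ k → ℕ→ℚ-mono-≤ (∣p─q∣≤∣p∣ (uncovered k) (N G (chosen k)))) greedy-step t n₂≤tε²n₂

lemma4p1 : (d ε : ℚ) → 0ℚ < ε → ε + ε < d →
    Σ ℕ λ t → Σ ℕ λ N₀ →
    ∀ (n₁ n₂ : ℕ) (G : BipGraph n₁ n₂) →
    IsRegular ε G →
    d ≤ density G ⊤ ⊤ →
    n₁ ≥ N₀ →
    Σ (Fin t → Fin n₁) λ u →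
    (1ℚ - ε) * ℕ→ℚ n₂ ≤ ℕ→ℚ ∣ NbUnion G u ∣
lemma4p1 d ε 0<ε 2ε<d =
  let t , 1≤tε² = archimedean (ε * ε) (0<p⇒0<p*p 0<ε) in
  t , 1 , λ where
    (suc n₁) n₂ G regular d≤density _ → Greedy.choice G t , Sum.[
      (λ ε≤1 → Greedy.greedy-covers G 0<ε ε≤1 2ε<d regular d≤density t 1≤tε²) ,
      1≤p⇒[1-p]*m≤n n₂ ∣ NbUnion G (Greedy.choice G t) ∣ ]′ (≤-total ε 1ℚ)
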